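{- Let $q$ be a prime, $F=\mathbb{Z}/q\mathbb{Z}$, $F^*=F\setminus\{0\}$, let $A\subset F$ and $\xi\in F^*$, and suppose $|S_\xi(A)|<|A|^2$. Then $|I(A)|\ge|S_\xi(A)|$.
   Context: For $A\subset F$ and $\xi\in F$, $S_\xi(A):=\{a+b\xi:a,b\in A\}$, and $$I(A):=\{a_1(a_2-a_3)+a_4(a_5-a_6):a_1,\dots,a_6\in A\}.$$ -}

module Defs where

open import Data.Nat using (ℕ; NonZero; _+_; _*_; _∸_)
open import Data.Nat.DivMod using (_mod_)
open import Data.Fin using (Fin; toℕ)
open import Data.Fin.Subset using (Subset; ⁅_⁆; ⋃)
open import Data.Fin.Subset.Properties using (_∈?_)
open import Data.List using (List; filter; concatMap; [_])
open import Data.List.Base using (allFin)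

module ZMod (q : ℕ) .{{_ : NonZero q}} where

  infixl 6 _+F_ _-F_
  infixl 7 _*F_

  _+F_ : Fin q → Fin q → Fin q
  a +F b = (toℕ a + toℕ b) mod q

  _*F_ : Fin q → Fin q → Fin q
  a *F b = (toℕ a * toℕ b) mod q

  -F_ : Fin q → Fin q
  -F b = (q ∸ toℕ b) mod q

  _-F_ : Fin q → Fin q → Fin q
  a -F b = a +F (-F b)

  elems : Subset q → List (Fin q)
  elems A = filter (_∈? A) (allFin q)

  S : Fin q → Subset q → Subset q
  S ξ A = ⋃ (concatMap (λ a → concatMap (λ b → [ ⁅ a +F b *F ξ ⁆ ]) (elems A)) (elems A))

  I : Subset q → Subset q
  I A = ⋃ (concatMap (λ a₁ → concatMap (λ a₂ → concatMap (λ a₃ →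
          concatMap (λ a₄ → concatMap (λ a₅ → concatMap (λ a₆ →
            [ ⁅ a₁ *F (a₂ -F a₃) +F a₄ *F (a₅ -F a₆) ⁆ ])
          (elems A)) (elems A)) (elems A)) (elems A)) (elems A)) (elems A))

-- Since |S_ξ(A)| < |A|², two distinct pairs collide: a + bξ = c + dξ, and b ≠ d because
-- otherwise a = c as well. Writing t = d − b ≠ 0 we get tξ = a − c, hence
-- t(x + yξ) = x(d − b) + y(a − c) ∈ I(A) for all x, y ∈ A. Multiplication by t is
-- injective in the prime field, so it embeds S_ξ(A) into I(A).
module Submission where

open import Defs
open import Data.Nat as ℕ using (ℕ; NonZero)
open import Data.Nat.Primality using (Prime; euclidsLemma)
open import Data.Fin using (Fin; toℕ; zero; suc; remQuot)
open import Data.Fin.Properties using (suc-injective; injective⇒≤; pigeonhole; *↔×; <⇒≢)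
open import Data.Fin.Subset using (Subset; _∈_; inside; outside; ⋃)
open import Data.Fin.Subset.Properties using (x∈p∪q⁺; x∈p∪q⁻; ∉⊥; x∈⁅x⁆; x∈⁅y⁆⇒x≡y; _∈?_)
open import Data.Vec.Base using (_∷_; here; there)
open import Data.List using (List; []; _∷_; allFin)
open import Data.List.Relation.Unary.Any as Any using (Any)
open import Data.List.Relation.Unary.Any.Properties using (concatMap⁺; concatMap⁻; singleton⁻)
open import Data.List.Membership.Propositional using (find; lose)
open import Data.List.Membership.Propositional.Properties using (∈-filter⁺; ∈-filter⁻; ∈-allFin)
open import Data.Product using (∃; ∃₂; _×_; _,_; proj₁; proj₂; map; uncurry)
open import Data.Sum as Sum using (_⊎_; inj₁; inj₂)
open import Data.Empty using (⊥-elim)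
open import Function using (_∘_; Injective)
open import Function.Bundles using (Injection)
open import Function.Properties.Inverse using (Inverse⇒Injection)
open import Relation.Binary.PropositionalEquality using (_≡_; _≢_; refl; sym; trans; cong; cong₂; subst)

module ModularCongruence (n : ℕ) where

  open import Data.Integer using (ℤ; +_; 0ℤ; _+_; _-_; _*_; -_)
  open import Data.Integer.Properties using (+-inverseʳ; +-identityʳ)
  open import Data.Integer.Divisibility.Signed using (_∣_; divides; ∣-refl; ∣m∣n⇒∣m+n; ∣m⇒∣-m; ∣m⇒∣m*n; ∣n⇒∣m*n)
  open import Data.Integer.Tactic.RingSolver using (solve-∀)
  open import Relation.Binary.Bundles using (Setoid)

  -- A record rather than a synonym for + n ∣ x - y, so that x and y can be inferred from a proof.
  infix 4 _≈_
  record _≈_ (x y : ℤ) : Set where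
    constructor mk≈
    field n∣x-y : + n ∣ x - y
  open _≈_ public

  private variable
    x y z u v : ℤ

  ≈-by-difference : x - y ≡ z → + n ∣ z → x ≈ y
  ≈-by-difference x-y≡z n∣z = mk≈ (subst (+ n ∣_) (sym x-y≡z) n∣z)

  ≈-refl : x ≈ x
  ≈-refl {x} = ≈-by-difference (+-inverseʳ x) (divides 0ℤ refl)

  ≈-sym : x ≈ y → y ≈ x
  ≈-sym {x} {y} (mk≈ n∣x-y) = ≈-by-difference (swap x y) (∣m⇒∣-m n∣x-y)
    where
    swap : ∀ x y → y - x ≡ - (x - y)
    swap = solve-∀

  ≈-trans : x ≈ y → y ≈ z → x ≈ z
  ≈-trans {x} {y} {z} (mk≈ n∣x-y) (mk≈ n∣y-z) =
    ≈-by-difference (telescope x y z) (∣m∣n⇒∣m+n n∣x-y n∣y-z)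
    where
    telescope : ∀ x y z → x - z ≡ (x - y) + (y - z)
    telescope = solve-∀

  multiple≈0 : ∀ k → k * + n ≈ 0ℤ
  multiple≈0 k = ≈-by-difference (+-identityʳ (k * + n)) (divides k refl)

  n≈0 : + n ≈ 0ℤ
  n≈0 = ≈-by-difference (+-identityʳ (+ n)) ∣-refl

  x-y≈0⇒x≈y : x - y ≈ 0ℤ → x ≈ y
  x-y≈0⇒x≈y {x} {y} (mk≈ n∣x-y-0) = ≈-by-difference (sym (+-identityʳ (x - y))) n∣x-y-0

  ≈-setoid : Setoid _ _
  ≈-setoid = record
    { Carrier       = ℤ
    ; _≈_           = _≈_
    ; isEquivalence = record { refl = ≈-refl ; sym = ≈-sym ; trans = ≈-trans }
    }

  +-cong : x ≈ y → u ≈ v → x + u ≈ y + v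
  +-cong {x} {y} {u} {v} (mk≈ n∣x-y) (mk≈ n∣u-v) =
    ≈-by-difference (regroup x y u v) (∣m∣n⇒∣m+n n∣x-y n∣u-v)
    where
    regroup : ∀ x y u v → (x + u) - (y + v) ≡ (x - y) + (u - v)
    regroup = solve-∀

  *-cong : x ≈ y → u ≈ v → x * u ≈ y * v
  *-cong {x} {y} {u} {v} (mk≈ n∣x-y) (mk≈ n∣u-v) =
    ≈-by-difference (regroup x y u v) (∣m∣n⇒∣m+n (∣m⇒∣m*n u n∣x-y) (∣n⇒∣m*n y n∣u-v))
    where
    regroup : ∀ x y u v → x * u - y * v ≡ (x - y) * u + y * (u - v)
    regroup = solve-∀

module _ where

  open import Data.Integer using (ℤ; +_; 0ℤ; _+_; _-_; _*_; -_; _⊖_)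
  import Data.Integer as ℤ
  open import Data.Integer.Properties
    using (+-identityˡ; +-identityʳ; +-injective; pos-+; pos-*; abs-*; m-n≡m⊖n; ⊖-≥; ∣m⊝n∣≤m⊔n; i-j≡0⇒i≡j)
  open import Data.Integer.Divisibility.Signed using (_∣_; ∣⇒∣ᵤ; ∣ᵤ⇒∣; ∣n⇒∣m*n)
  import Data.Nat.Divisibility as ℕ
  import Data.Nat.Properties as ℕ
  open import Data.Nat.DivMod using (_mod_; _%_; _/_; m%n<n; m≡m%n+[m/n]*n)
  open import Data.Fin.Properties using (toℕ-fromℕ<; toℕ-injective; toℕ<n)
  open import Data.Integer.Tactic.RingSolver using (solve-∀)

  n∣i∧∣i∣<n⇒i≡0 : ∀ {n i} → + n ∣ i → ℤ.∣ i ∣ ℕ.< n → i ≡ 0ℤ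
  n∣i∧∣i∣<n⇒i≡0 {i = + 0}        _   _     = refl
  n∣i∧∣i∣<n⇒i≡0 {i = ℤ.+[1+ _ ]} n∣i ∣i∣<n = ⊥-elim (ℕ.>⇒∤ ∣i∣<n (∣⇒∣ᵤ n∣i))
  n∣i∧∣i∣<n⇒i≡0 {i = ℤ.-[1+ _ ]} n∣i ∣i∣<n = ⊥-elim (ℕ.>⇒∤ ∣i∣<n (∣⇒∣ᵤ n∣i))

  euclidsLemmaℤ : ∀ i j {p} → Prime p → + p ∣ i * j → + p ∣ i ⊎ + p ∣ j
  euclidsLemmaℤ i j p-prime p∣ij =
    Sum.map ∣ᵤ⇒∣ ∣ᵤ⇒∣ (euclidsLemma ℤ.∣ i ∣ ℤ.∣ j ∣ p-prime
                                     (subst (ℕ._∣_ _) (abs-* i j) (∣⇒∣ᵤ p∣ij)))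

  module _ {q : ℕ} .{{_ : NonZero q}} where
    open ZMod q
    open ModularCongruence q
    open import Relation.Binary.Reasoning.Setoid ≈-setoid

    toℤ : Fin q → ℤ
    toℤ a = + toℕ a

    private variable
      a b c d t x y ξ : Fin q

    toℤ-mod : ∀ m → toℤ (m mod q) ≈ + m
    toℤ-mod m = begin
      + toℕ (m mod q)                   ≡⟨ cong +_ (toℕ-fromℕ< (m%n<n m q)) ⟩
      + (m % q)                         ≡⟨ +-identityʳ (+ (m % q)) ⟨
      + (m % q) + 0ℤ                    ≈⟨ +-cong (≈-refl {x = + (m % q)}) (multiple≈0 (+ (m / q))) ⟨
      + (m % q) + + (m / q) * + q       ≡⟨ cong (_+_ (+ (m % q))) (pos-* (m / q) q) ⟨
      + (m % q) + + (m / q ℕ.* q)       ≡⟨ pos-+ (m % q) (m / q ℕ.* q) ⟨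
      + (m % q ℕ.+ m / q ℕ.* q)         ≡⟨ cong +_ (m≡m%n+[m/n]*n m q) ⟨
      + m                               ∎

    toℤ-+F : ∀ a b → toℤ (a +F b) ≈ toℤ a + toℤ b
    toℤ-+F a b = toℤ-mod (toℕ a ℕ.+ toℕ b)

    toℤ-*F : ∀ a b → toℤ (a *F b) ≈ toℤ a * toℤ b
    toℤ-*F a b = begin
      toℤ (a *F b)              ≈⟨ toℤ-mod (toℕ a ℕ.* toℕ b) ⟩
      + (toℕ a ℕ.* toℕ b)       ≡⟨ pos-* (toℕ a) (toℕ b) ⟩
      toℤ a * toℤ b             ∎

    toℤ-negF : ∀ b → toℤ (-F b) ≈ - toℤ b
    toℤ-negF b = begin
      toℤ (-F b)                ≈⟨ toℤ-mod (q ℕ.∸ toℕ b) ⟩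
      + (q ℕ.∸ toℕ b)           ≡⟨ ⊖-≥ (ℕ.<⇒≤ (toℕ<n b)) ⟨
      q ⊖ toℕ b                 ≡⟨ m-n≡m⊖n q (toℕ b) ⟨
      + q - toℤ b               ≈⟨ +-cong n≈0 (≈-refl {x = - toℤ b}) ⟩
      0ℤ - toℤ b                ≡⟨ +-identityˡ (- toℤ b) ⟩
      - toℤ b                   ∎

    toℤ--F : ∀ a b → toℤ (a -F b) ≈ toℤ a - toℤ b
    toℤ--F a b = ≈-trans (toℤ-+F a (-F b)) (+-cong (≈-refl {x = toℤ a}) (toℤ-negF b))

    toℤ-injective : toℤ a ≈ toℤ b → a ≡ b
    toℤ-injective {a} {b} (mk≈ q∣a-b) =
      toℕ-injective (+-injective (i-j≡0⇒i≡j (toℤ a) (toℤ b) (n∣i∧∣i∣<n⇒i≡0 q∣a-b ∣a-b∣<q)))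
      where
      ∣a-b∣<q : ℤ.∣ toℤ a - toℤ b ∣ ℕ.< q
      ∣a-b∣<q = subst (ℕ._< q) (cong ℤ.∣_∣ (sym (m-n≡m⊖n (toℕ a) (toℕ b))))
                  (ℕ.≤-<-trans (∣m⊝n∣≤m⊔n (toℕ a) (toℕ b)) (ℕ.⊔-pres-<m (toℕ<n a) (toℕ<n b)))

    +F-cancelʳ : a +F c ≡ b +F c → a ≡ b
    +F-cancelʳ {a} {c} {b} a+c≡b+c =
      toℤ-injective (≈-by-difference (cancel (toℤ a) (toℤ b) (toℤ c)) (n∣x-y ac≈bc))
      where
      ac≈bc : toℤ a + toℤ c ≈ toℤ b + toℤ c
      ac≈bc = begin
        toℤ a + toℤ c      ≈⟨ toℤ-+F a c ⟨
        toℤ (a +F c)       ≡⟨ cong toℤ a+c≡b+c ⟩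
        toℤ (b +F c)       ≈⟨ toℤ-+F b c ⟩
        toℤ b + toℤ c      ∎

      cancel : ∀ a b c → a - b ≡ (a + c) - (b + c)
      cancel = solve-∀

    ≢⇒-F≢0 : a ≢ b → toℕ (a -F b) ≢ 0
    ≢⇒-F≢0 {a} {b} a≢b a-b≡0 = a≢b (toℤ-injective (x-y≈0⇒x≈y (begin
      toℤ a - toℤ b       ≈⟨ toℤ--F a b ⟨
      toℤ (a -F b)        ≡⟨ cong +_ a-b≡0 ⟩
      0ℤ                  ∎)))

    *F-cancelˡ : Prime q → toℕ t ≢ 0 → t *F x ≡ t *F y → x ≡ y
    *F-cancelˡ {t} {x} {y} q-prime t≢0 tx≡ty =
      Sum.[ (λ q∣t → ⊥-elim (t≢0 (+-injective (n∣i∧∣i∣<n⇒i≡0 q∣t (toℕ<n t)))))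
          , (λ q∣x-y → toℤ-injective (mk≈ q∣x-y))
          ]′ (euclidsLemmaℤ (toℤ t) (toℤ x - toℤ y) q-prime q∣t[x-y])
      where
      factor : ∀ t x y → t * x - t * y ≡ t * (x - y)
      factor = solve-∀

      q∣t[x-y] : + q ∣ toℤ t * (toℤ x - toℤ y)
      q∣t[x-y] = subst (+ q ∣_) (factor (toℤ t) (toℤ x) (toℤ y)) (n∣x-y (begin
        toℤ t * toℤ x     ≈⟨ toℤ-*F t x ⟨
        toℤ (t *F x)      ≡⟨ cong toℤ tx≡ty ⟩
        toℤ (t *F y)      ≈⟨ toℤ-*F t y ⟩
        toℤ t * toℤ y     ∎))

    toℤ-affine : ∀ x y ξ → toℤ (x +F y *F ξ) ≈ toℤ x + toℤ y * toℤ ξ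
    toℤ-affine x y ξ = ≈-trans (toℤ-+F x (y *F ξ)) (+-cong (≈-refl {x = toℤ x}) (toℤ-*F y ξ))

    rescale-by-collision : a +F b *F ξ ≡ c +F d *F ξ →
                           ∀ x y → (d -F b) *F (x +F y *F ξ) ≡ x *F (d -F b) +F y *F (a -F c)
    rescale-by-collision {a} {b} {ξ} {c} {d} collision x y = toℤ-injective (begin
      toℤ ((d -F b) *F (x +F y *F ξ))              ≈⟨ toℤ-*F (d -F b) _ ⟩
      toℤ (d -F b) * toℤ (x +F y *F ξ)             ≈⟨ *-cong (toℤ--F d b) (toℤ-affine x y ξ) ⟩
      (D - B) * (X + Y * Ξ)                        ≈⟨ uses-collision ⟩
      X * (D - B) + Y * (A - C)                    ≈⟨ +-cong (*-cong (≈-refl {x = X}) (toℤ--F d b))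
                                                             (*-cong (≈-refl {x = Y}) (toℤ--F a c)) ⟨
      X * toℤ (d -F b) + Y * toℤ (a -F c)          ≈⟨ +-cong (toℤ-*F x (d -F b)) (toℤ-*F y (a -F c)) ⟨
      toℤ (x *F (d -F b)) + toℤ (y *F (a -F c))    ≈⟨ toℤ-+F (x *F (d -F b)) (y *F (a -F c)) ⟨
      toℤ (x *F (d -F b) +F y *F (a -F c))         ∎)
      where
      A B C D X Y Ξ : ℤ
      A = toℤ a; B = toℤ b; C = toℤ c; D = toℤ d; X = toℤ x; Y = toℤ y; Ξ = toℤ ξ

      cd≈ab : C + D * Ξ ≈ A + B * Ξ
      cd≈ab = begin
        C + D * Ξ          ≈⟨ toℤ-affine c d ξ ⟨
        toℤ (c +F d *F ξ)  ≡⟨ cong toℤ collision ⟨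
        toℤ (a +F b *F ξ)  ≈⟨ toℤ-affine a b ξ ⟩
        A + B * Ξ          ∎

      rescale : ∀ a b c d x y ξ →
                (d - b) * (x + y * ξ) - (x * (d - b) + y * (a - c)) ≡ y * ((c + d * ξ) - (a + b * ξ))
      rescale = solve-∀

      uses-collision : (D - B) * (X + Y * Ξ) ≈ X * (D - B) + Y * (A - C)
      uses-collision = ≈-by-difference (rescale A B C D X Y Ξ) (∣n⇒∣m*n Y (n∣x-y cd≈ab))

open import Data.Nat using (_<_; _≤_; _*_)
open import Data.Fin.Subset using (∣_∣)

private variable
  n m : ℕ

pigeonhole-× : ∀ {a b m} → m < a * b → (h : Fin a × Fin b → Fin m) →
               ∃₂ λ u v → u ≢ v × h u ≡ h v
pigeonhole-× m<ab h with k , l , k<l , hk≡hl ← pigeonhole m<ab (h ∘ remQuot _)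
  = _ , _ , <⇒≢ k<l ∘ Injection.injective (Inverse⇒Injection *↔×) , hk≡hl

enum : (p : Subset n) → Fin ∣ p ∣ → Fin n
enum (inside  ∷ p) zero    = zero
enum (inside  ∷ p) (suc i) = suc (enum p i)
enum (outside ∷ p) i       = suc (enum p i)

enum-∈ : ∀ (p : Subset n) i → enum p i ∈ p
enum-∈ (inside  ∷ p) zero    = here
enum-∈ (inside  ∷ p) (suc i) = there (enum-∈ p i)
enum-∈ (outside ∷ p) i       = there (enum-∈ p i)

enum-injective : ∀ (p : Subset n) → Injective _≡_ _≡_ (enum p)
enum-injective (inside  ∷ p) {zero}  {zero}  _  = refl
enum-injective (inside  ∷ p) {suc i} {suc j} eq = cong suc (enum-injective p (suc-injective eq))
enum-injective (outside ∷ p)                 eq = enum-injective p (suc-injective eq)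

index : ∀ {p : Subset n} {x} → x ∈ p → Fin ∣ p ∣
index {p = inside  ∷ p} here        = zero
index {p = inside  ∷ p} (there x∈p) = suc (index x∈p)
index {p = outside ∷ p} (there x∈p) = index x∈p

enum-index : ∀ {p : Subset n} {x} (x∈p : x ∈ p) → enum p (index x∈p) ≡ x
enum-index {p = inside  ∷ p} here        = refl
enum-index {p = inside  ∷ p} (there x∈p) = cong suc (enum-index x∈p)
enum-index {p = outside ∷ p} (there x∈p) = cong suc (enum-index x∈p)

index-injective : ∀ {p : Subset n} {x y} (x∈p : x ∈ p) (y∈p : y ∈ p) →
                  index x∈p ≡ index y∈p → x ≡ y
index-injective {p = p} x∈p y∈p eq =
  trans (sym (enum-index x∈p)) (trans (cong (enum p) eq) (enum-index y∈p))

∣p∣≤∣q∣-by-injection : ∀ {p : Subset n} {q : Subset m} {f : Fin n → Fin m} →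
                       Injective _≡_ _≡_ f → (∀ {x} → x ∈ p → f x ∈ q) → ∣ p ∣ ≤ ∣ q ∣
∣p∣≤∣q∣-by-injection {p = p} f-injective f[p]⊆q = injective⇒≤ {f = g} g-injective
  where
  g : Fin ∣ p ∣ → Fin _
  g i = index (f[p]⊆q (enum-∈ p i))

  g-injective : Injective _≡_ _≡_ g
  g-injective {i} {j} eq =
    enum-injective p (f-injective (index-injective (f[p]⊆q (enum-∈ p i)) (f[p]⊆q (enum-∈ p j)) eq))

pair-collision : ∀ {p : Subset n} {r : Subset m} (f : Fin n → Fin n → Fin m) →
                 (∀ {x y} → x ∈ p → y ∈ p → f x y ∈ r) → ∣ r ∣ < ∣ p ∣ * ∣ p ∣ →
                 ∃₂ λ a b → ∃₂ λ c d → (a ∈ p × b ∈ p × c ∈ p × d ∈ p) ×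
                                       (a , b) ≢ (c , d) × f a b ≡ f c d
pair-collision {p = p} f f[p,p]⊆r ∣r∣<∣p∣²
  with (i , j) , (k , l) , ij≢kl , gij≡gkl ←
       pigeonhole-× ∣r∣<∣p∣² (uncurry λ i j → index (f[p,p]⊆r (enum-∈ p i) (enum-∈ p j)))
  = _ , _ , _ , _ , (enum-∈ p i , enum-∈ p j , enum-∈ p k , enum-∈ p l)
  , ij≢kl ∘ enum²-injective
  , index-injective (f[p,p]⊆r (enum-∈ p i) (enum-∈ p j)) (f[p,p]⊆r (enum-∈ p k) (enum-∈ p l)) gij≡gkl
  where
  enum²-injective : Injective _≡_ _≡_ (map (enum p) (enum p))
  enum²-injective eq =
    cong₂ _,_ (enum-injective p (cong proj₁ eq)) (enum-injective p (cong proj₂ eq))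

x∈⋃⁺ : ∀ {ps : List (Subset n)} {x} → Any (x ∈_) ps → x ∈ ⋃ ps
x∈⋃⁺ (Any.here x∈p)   = x∈p∪q⁺ (inj₁ x∈p)
x∈⋃⁺ (Any.there x∈ps) = x∈p∪q⁺ (inj₂ (x∈⋃⁺ x∈ps))

x∈⋃⁻ : ∀ (ps : List (Subset n)) {x} → x ∈ ⋃ ps → Any (x ∈_) ps
x∈⋃⁻ []       x∈⊥  = ⊥-elim (∉⊥ x∈⊥)
x∈⋃⁻ (p ∷ ps) x∈⋃ with x∈p∪q⁻ p (⋃ ps) x∈⋃
... | inj₁ x∈p   = Any.here x∈p
... | inj₂ x∈⋃ps = Any.there (x∈⋃⁻ ps x∈⋃ps)

module _ {q : ℕ} .{{_ : NonZero q}} {A : Subset q} where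
  open ZMod q

  private variable
    a b c d x : Fin q

  elems⁺ : ∀ {P : Fin q → Set} → x ∈ A → P x → Any P (elems A)
  elems⁺ {x = x} x∈A = lose (∈-filter⁺ (_∈? A) (∈-allFin x) x∈A)

  elems⁻ : ∀ {P : Fin q → Set} → Any P (elems A) → ∃ λ x → x ∈ A × P x
  elems⁻ P[elems] with x , x∈elems , Px ← find P[elems] =
    x , proj₂ (∈-filter⁻ (_∈? A) {xs = allFin q} x∈elems) , Px

  ∈S⁺ : ∀ {ξ} → a ∈ A → b ∈ A → a +F b *F ξ ∈ S ξ A
  ∈S⁺ a∈A b∈A = x∈⋃⁺ (concatMap⁺ _ (elems⁺ a∈A (concatMap⁺ _ (elems⁺ b∈A (Any.here (x∈⁅x⁆ _))))))

  ∈S⁻ : ∀ {ξ z} → z ∈ S ξ A → ∃₂ λ x y → x ∈ A × y ∈ A × z ≡ x +F y *F ξ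
  ∈S⁻ z∈S =
    let x , x∈A , z∈Sx  = elems⁻ (concatMap⁻ _ (x∈⋃⁻ _ z∈S))
        y , y∈A , z∈Sxy = elems⁻ (concatMap⁻ _ z∈Sx)
    in x , y , x∈A , y∈A , x∈⁅y⁆⇒x≡y _ (singleton⁻ z∈Sxy)

  ∈I⁺ : ∀ {a₁ a₂ a₃ a₄ a₅ a₆} → a₁ ∈ A → a₂ ∈ A → a₃ ∈ A → a₄ ∈ A → a₅ ∈ A → a₆ ∈ A →
        a₁ *F (a₂ -F a₃) +F a₄ *F (a₅ -F a₆) ∈ I A
  ∈I⁺ a₁∈A a₂∈A a₃∈A a₄∈A a₅∈A a₆∈A =
    x∈⋃⁺ (concatMap⁺ _ (elems⁺ a₁∈A (concatMap⁺ _ (elems⁺ a₂∈A (concatMap⁺ _ (elems⁺ a₃∈A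
      (concatMap⁺ _ (elems⁺ a₄∈A (concatMap⁺ _ (elems⁺ a₅∈A (concatMap⁺ _ (elems⁺ a₆∈A
        (Any.here (x∈⁅x⁆ _))))))))))))))

  collision⇒∣S∣≤∣I∣ : ∀ {ξ} → Prime q → a ∈ A → b ∈ A → c ∈ A → d ∈ A → (a , b) ≢ (c , d) →
                      a +F b *F ξ ≡ c +F d *F ξ → ∣ S ξ A ∣ ≤ ∣ I A ∣
  collision⇒∣S∣≤∣I∣ {a} {b} {c} {d} {ξ} q-prime a∈A b∈A c∈A d∈A ab≢cd collision =
    ∣p∣≤∣q∣-by-injection (*F-cancelˡ q-prime (≢⇒-F≢0 (b≢d ∘ sym))) [d-b]S⊆I
    where
    b≢d : b ≢ d
    b≢d refl = ab≢cd (cong (_, b) (+F-cancelʳ collision))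

    [d-b]S⊆I : ∀ {z} → z ∈ S ξ A → (d -F b) *F z ∈ I A
    [d-b]S⊆I z∈S with x , y , x∈A , y∈A , z≡x+yξ ← ∈S⁻ z∈S =
      subst (_∈ I A) (sym (trans (cong ((d -F b) *F_) z≡x+yξ) rescaled))
            (∈I⁺ x∈A d∈A b∈A y∈A a∈A c∈A)
      where
      rescaled : (d -F b) *F (x +F y *F ξ) ≡ x *F (d -F b) +F y *F (a -F c)
      rescaled = rescale-by-collision {b = b} {ξ = ξ} collision x y

lemma1 : (q : ℕ) .{{_ : NonZero q}} → Prime q →
    (A : Subset q) (ξ : Fin q) → toℕ ξ ≢ 0 →
    ∣ ZMod.S q ξ A ∣ < ∣ A ∣ * ∣ A ∣ →
    ∣ ZMod.S q ξ A ∣ ≤ ∣ ZMod.I q A ∣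
lemma1 q q-prime A ξ _ ∣S∣<∣A∣²
  with _ , _ , _ , _ , (a∈A , b∈A , c∈A , d∈A) , ab≢cd , collision ←
       pair-collision _ (∈S⁺ {ξ = ξ}) ∣S∣<∣A∣²
  = collision⇒∣S∣≤∣I∣ q-prime a∈A b∈A c∈A d∈A ab≢cd collision
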